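{- Let $P$ be a set of permutations consisting of exactly one permutation of each length $l\ge4$ (and no permutations of length less than $4$). Let $\alpha\approx1.068290263$ be the smallest positive root of $e^t-2t-\frac{t^2}{2}-\frac{t^3}{6}=0$. Then for every $n\ge0$ the number of permutations of length $n$ avoiding every pattern of $P$ as a consecutive pattern is at least $\alpha^{ -n}\,n!$. In particular, for every $n$ there exist permutations of length $n$ avoiding $P$, regardless of the actual choice of the patterns in $P$.
   Context: For a word $s=s_1\dots s_k$ of distinct integers, $\mathrm{st}(s)$ is the permutation $\pi$ of $\{1,\dots,k\}$ with $s_i<s_j\iff\pi_i<\pi_j$. A permutation $\sigma=\sigma_1\dots\sigma_n$ contains the consecutive pattern $\pi$ of length $j$ if $\mathrm{st}(\sigma_i\dots\sigma_{i+j-1})=\pi$ for some $i$, and avoids it otherwise. -}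

module Defs where

open import Data.Nat as ℕ using (ℕ; zero; suc; _+_; _≤_)
open import Data.Nat.Properties using (+-monoʳ-<; <-≤-trans)
open import Data.Nat.Base using (_!)
open import Data.Nat.Properties using (_!≢0)
open import Data.Fin as Fin using (Fin; toℕ; fromℕ<)
open import Data.Fin.Properties using (toℕ<n)
open import Data.Vec using (Vec; lookup)
open import Data.Integer using (+_)
open import Data.Rational as ℚ using (ℚ; 0ℚ; 1ℚ; _/_)
open import Data.Product using (Σ; ∃-syntax; _×_)
open import Relation.Binary.PropositionalEquality using (_≡_)
open import Relation.Nullary using (¬_)
open import Function.Bundles using (_⇔_)

Word : ℕ → Set
Word n = Vec (Fin n) n

IsPerm : {n : ℕ} → Word n → Set
IsPerm {n} σ = (i j : Fin n) → lookup σ i ≡ lookup σ j → i ≡ j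

idx : {i j n : ℕ} → i + j ≤ n → Fin j → Fin n
idx {i} h a = fromℕ< (<-≤-trans (+-monoʳ-< i (toℕ<n a)) h)

ContainsConsecAt : {n j : ℕ} → Word n → Word j → (i : ℕ) → Set
ContainsConsecAt {n} {j} σ π i =
  Σ (i + j ≤ n) λ h → (a b : Fin j) →
    (lookup σ (idx h a) Fin.< lookup σ (idx h b)) ⇔ (lookup π a Fin.< lookup π b)

ContainsConsec : {n j : ℕ} → Word n → Word j → Set
ContainsConsec σ π = ∃[ i ] ContainsConsecAt σ π i

PatternSet : Set
PatternSet = (l : ℕ) → 4 ≤ l → Word l

AvoidsAll : {n : ℕ} → PatternSet → Word n → Set
AvoidsAll P σ = ∀ l (h : 4 ≤ l) → ¬ ContainsConsec σ (P l h)

ℕtoℚ : ℕ → ℚ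
ℕtoℚ n = + n / 1

_^ℚ_ : ℚ → ℕ → ℚ
q ^ℚ zero  = 1ℚ
q ^ℚ suc k = q ℚ.* (q ^ℚ k)

expPartial : ℕ → ℚ → ℚ
expPartial zero    s = 0ℚ
expPartial (suc N) s = expPartial N s ℚ.+ (s ^ℚ N) ℚ.* ((+ 1 / (N !)) {{N !≢0}})

-- α is the smallest positive root of f(t) = e^t - 2t - t²/2 - t³/6.
-- Since there are no reals, α is handled through its upper rational cut:
-- AboveAlpha r  iff  some rational s with 0 < s < r has f(s) < 0,
-- where f(s) < 0 is expressed as: ∃ ε > 0 with
-- 6·(Σ_{k<N} s^k/k!) + ε ≤ 12s + 3s² + s³ for all N.
-- (For rational r this holds exactly when α < r.)
AboveAlpha : ℚ → Set
AboveAlpha r = ∃[ s ] (0ℚ ℚ.< s × s ℚ.< r ×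
  ∃[ ε ] (0ℚ ℚ.< ε × ((N : ℕ) →
    ℕtoℚ 6 ℚ.* expPartial N s ℚ.+ ε ℚ.≤
      ℕtoℚ 12 ℚ.* s ℚ.+ ℕtoℚ 3 ℚ.* (s ^ℚ 2) ℚ.+ s ^ℚ 3)))

{-# OPTIONS --safe #-}
module Submission where

-- Avoiders of length n + 1 are built from those of length n by choosing a first entry v and
-- shifting the old entries ≥ v up by one; an extension is discarded when it begins with the
-- pattern of some length l ≥ 4. A discarded extension is determined by the standardisation of
-- its last n + 1 − l entries (an avoider) and by its set of first l values, so with aₙ the
-- number of avoiders,
--   n aₙ₋₁ ≤ aₙ + Σ_{4 ≤ l ≤ n} C(n, l) aₙ₋ₗ.
-- If 1 + Σ_{l ≥ 4} sˡ / l! ≤ s, which is f(s) ≤ 0, strong induction shows that aₙ sⁿ / n! never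
-- decreases, so n! ≤ aₙ sⁿ ≤ aₙ rⁿ whenever f(s) < 0 for some s < r. The rational s = 3/2
-- qualifies, which gives the case r = 2 and hence the existence of avoiders of every length.

open import Defs
open import Data.Nat using (ℕ; _≤_)
open import Data.Nat.Base using (_!)
open import Data.Vec using (Vec)
open import Data.List using (List; length)
open import Data.List.Relation.Unary.All using (All)
open import Data.List.Relation.Unary.Unique.Propositional using (Unique)
open import Data.Rational as ℚ using (ℚ)
open import Data.Product using (Σ; ∃-syntax; _×_)

open import Data.Nat as ℕ using (zero; suc; _∸_; _<_; z≤n; s≤s)
import Data.Nat.Properties as ℕₚ
open import Data.Nat.Induction using (<-wellFounded)
open import Data.Nat.Combinatorics
  using (_C_; nCk≡nC[n∸k]; nCn≡1; k>n⇒nCk≡0; nCk+nC[k+1]≡[n+1]C[k+1]; nCk≡n!/k![n-k]!; k![n∸k]!∣n!)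
open import Data.Nat.DivMod using (m/n*n≡m)
open import Data.Integer as ℤ using (ℤ; +_)
import Data.Integer.Properties as ℤₚ
import Data.Integer.Tactic.RingSolver as ℤ-Solver
open import Data.Rational using (0ℚ; 1ℚ; toℚᵘ)
import Data.Rational.Properties as ℚₚ
import Data.Rational.Unnormalised as ℚᵘ
import Data.Rational.Unnormalised.Properties as ℚᵘₚ
open import Data.Rational.Solver using (module +-*-Solver)
open import Data.Fin as Fin using (Fin; zero; suc; toℕ; punchIn; punchOut; _↑ˡ_; _↑ʳ_; splitAt)
open import Data.Fin.Properties
  using (all?; any?; _<?_; _≟_; <-cmp; pigeonhole; injective⇒≤; toℕ<n; toℕ-injective; toℕ-fromℕ<;
         toℕ-↑ˡ; toℕ-↑ʳ; splitAt⁻¹-↑ˡ; splitAt⁻¹-↑ʳ; <-irrefl; ≤∧≢⇒<; <⇒≢;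
         punchOut-injective; punchIn-injective; punchInᵢ≢i; punchIn-mono-≤; punchIn-cancel-≤)
open import Data.Vec as Vec using ([]; _∷_; lookup; tabulate)
open import Data.Vec.Properties using (lookup-map; lookup∘tabulate; tabulate∘lookup; tabulate-cong; ∷-injective)
open import Data.List as List using ([]; _∷_; [_]; _++_; filter; cartesianProductWith; cartesianProduct; allFin)
open import Data.List.Properties using (length-++; length-map; length-tabulate; filter-none)
open import Data.List.Membership.Propositional using (_∈_)
open import Data.List.Membership.Propositional.Properties
  using (∈-lookup; ∈-map⁺; ∈-++⁺ˡ; ∈-++⁺ʳ; ∈-filter⁻; ∈-cartesianProductWith⁻; ∈-cartesianProduct⁺)
import Data.List.Membership.Setoid.Properties as Membership
open import Data.List.Relation.Unary.Any as Any using (here; there)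
import Data.List.Relation.Unary.All as All
import Data.List.Relation.Unary.AllPairs as AllPairs
import Data.List.Relation.Unary.Unique.Propositional.Properties as Unique
open import Data.Product using (_,_; proj₁; proj₂)
open import Data.Sum using (_⊎_; inj₁; inj₂)
open import Data.Empty using (⊥-elim)
open import Data.Unit using (tt)
open import Function using (_∘_; id)
open import Function.Bundles using (_⇔_; mk⇔; Equivalence)
import Function.Properties.Equivalence as ⇔
open import Function.Definitions using (Injective)
open import Induction.WellFounded using (Acc; acc)
open import Relation.Binary.Definitions using (tri<; tri≈; tri>)
open import Relation.Binary.PropositionalEquality hiding ([_])
open import Relation.Nullary using (¬_; Dec; yes; no; ¬?; Irrelevant)
open import Relation.Nullary.Decidable using (map′; _×-dec_; _→-dec_; toWitness)
open import Relation.Unary using (Decidable)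

module _ where

  open import Data.Nat using (_+_; _*_)

  private
    variable
      A B : Set
      i j l m n N M : ℕ

  SameOrder : (Fin j → Fin N) → (Fin j → Fin M) → Set
  SameOrder f g = ∀ a b → f a Fin.< f b ⇔ g a Fin.< g b

  module _ {f : Fin j → Fin N} {g : Fin j → Fin M} where

    sameOrder-sym : SameOrder f g → SameOrder g f
    sameOrder-sym f∼g a b = ⇔.sym (f∼g a b)

    sameOrder-trans : {K : ℕ} {h : Fin j → Fin K} → SameOrder f g → SameOrder g h → SameOrder f h
    sameOrder-trans f∼g g∼h a b = ⇔.trans (f∼g a b) (g∼h a b)

    sameOrder-respˡ : {f′ : Fin j → Fin N} → f ≗ f′ → SameOrder f g → SameOrder f′ g
    sameOrder-respˡ f≗f′ f∼g a b = subst₂ (λ x y → x Fin.< y ⇔ g a Fin.< g b) (f≗f′ a) (f≗f′ b) (f∼g a b)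

  sameOrder? : (f : Fin j → Fin N) (g : Fin j → Fin M) → Dec (SameOrder f g)
  sameOrder? f g = all? λ a → all? λ b → ⇔? (f a <? f b) (g a <? g b)
    where
    ⇔? : {A B : Set} → Dec A → Dec B → Dec (A ⇔ B)
    ⇔? A? B? = map′ (λ (to , from) → mk⇔ to from) (λ e → Equivalence.to e , Equivalence.from e)
                    ((A? →-dec B?) ×-dec (B? →-dec A?))

  punchIn-<⇔ : (v : Fin (suc n)) (x y : Fin n) → x Fin.< y ⇔ punchIn v x Fin.< punchIn v y
  punchIn-<⇔ v x y = mk⇔
    (λ x<y → ≤∧≢⇒< (punchIn-mono-≤ v x y (ℕₚ.<⇒≤ x<y)) (<⇒≢ x<y ∘ punchIn-injective v x y))
    (λ x<y → ≤∧≢⇒< (punchIn-cancel-≤ v x y (ℕₚ.<⇒≤ x<y)) (<⇒≢ x<y ∘ cong (punchIn v)))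

  sameOrder-punchIn : (v : Fin (suc N)) (f : Fin j → Fin N) → SameOrder (punchIn v ∘ f) f
  sameOrder-punchIn v f a b = ⇔.sym (punchIn-<⇔ v (f a) (f b))

  -- If f a < g a, write f a = g b; then g b < g a, hence f b < f a, and the same
  -- situation recurs at b with a smaller value of f: an infinite descent.
  module _ {f g : Fin j → Fin N} (f∼g : SameOrder f g) (f⊆g : ∀ a → ∃[ b ] f a ≡ g b) where

    private
      descent : ∀ a → Acc ℕ._<_ (toℕ (f a)) → ¬ f a Fin.< g a
      descent a (acc rs) fa<ga with f⊆g a
      ... | b , fa≡gb = descent b (rs fb<fa) (subst (f b Fin.<_) fa≡gb fb<fa)
        where
        fb<fa : f b Fin.< f a
        fb<fa = Equivalence.from (f∼g b a) (subst (Fin._< g a) fa≡gb fa<ga)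

    sameOrder∧⊆⇒≮ : ∀ a → ¬ f a Fin.< g a
    sameOrder∧⊆⇒≮ a = descent a (<-wellFounded _)

  sameOrder∧sameImage⇒≗ : {f g : Fin j → Fin N} → SameOrder f g →
    (∀ a → ∃[ b ] f a ≡ g b) → (∀ a → ∃[ b ] g a ≡ f b) → f ≗ g
  sameOrder∧sameImage⇒≗ {f = f} {g} f∼g f⊆g g⊆f a with <-cmp (f a) (g a)
  ... | tri< fa<ga _ _ = ⊥-elim (sameOrder∧⊆⇒≮ f∼g f⊆g a fa<ga)
  ... | tri≈ _ fa≡ga _ = fa≡ga
  ... | tri> _ _ ga<fa = ⊥-elim (sameOrder∧⊆⇒≮ (sameOrder-sym f∼g) g⊆f a ga<fa)

  injective⇒surjective : {f : Fin n → Fin n} → Injective _≡_ _≡_ f → ∀ y → ∃[ x ] f x ≡ y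
  injective⇒surjective {zero}  _ ()
  injective⇒surjective {suc n} {f} f-inj y with any? (λ x → f x ≟ y)
  ... | yes hit = hit
  ... | no miss =
    let i , j , i<j , fi≡fj = pigeonhole (ℕₚ.n<1+n n) (λ x → punchOut (f≢y x))
    in ⊥-elim (<-irrefl (f-inj (punchOut-injective (f≢y i) (f≢y j) fi≡fj)) i<j)
    where
    f≢y : ∀ x → y ≢ f x
    f≢y x y≡fx = miss (x , sym y≡fx)

  lookup-≗⇒≡ : {A : Set} {xs ys : Vec A n} → lookup xs ≗ lookup ys → xs ≡ ys
  lookup-≗⇒≡ {xs = xs} {ys} eq =
    trans (sym (tabulate∘lookup xs)) (trans (tabulate-cong eq) (tabulate∘lookup ys))

  splitAt-view : (l : ℕ) {m : ℕ} (p : Fin (l + m)) → (∃[ b ] b ↑ˡ m ≡ p) ⊎ (∃[ c ] l ↑ʳ c ≡ p)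
  splitAt-view l p with splitAt l p in eq
  ... | inj₁ b = inj₁ (b , splitAt⁻¹-↑ˡ eq)
  ... | inj₂ c = inj₂ (c , splitAt⁻¹-↑ʳ eq)

  ∑[<]-syntax : ℕ → (ℕ → ℕ) → ℕ
  ∑[<]-syntax zero    f = 0
  ∑[<]-syntax (suc N) f = ∑[<]-syntax N f + f N

  syntax ∑[<]-syntax N (λ l → e) = ∑[ l < N ] e

  ∑-mono-≤ : (N : ℕ) {f g : ℕ → ℕ} → (∀ {l} → l < N → f l ≤ g l) → ∑[ l < N ] f l ≤ ∑[ l < N ] g l
  ∑-mono-≤ zero    f≤g = z≤n
  ∑-mono-≤ (suc N) f≤g = ℕₚ.+-mono-≤ (∑-mono-≤ N (f≤g ∘ ℕₚ.m≤n⇒m≤1+n)) (f≤g ℕₚ.≤-refl)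

  ∑-mono-< : (N : ℕ) {f g : ℕ → ℕ} {l₀ : ℕ} → (∀ {l} → l < N → f l ≤ g l) → l₀ < N → f l₀ < g l₀ →
    ∑[ l < N ] f l < ∑[ l < N ] g l
  ∑-mono-< (suc N) {l₀ = l₀} f≤g l₀<1+N fl₀<gl₀ with ℕₚ.m≤n⇒m<n∨m≡n (ℕₚ.≤-pred l₀<1+N)
  ... | inj₁ l₀<N = ℕₚ.+-mono-<-≤ (∑-mono-< N (f≤g ∘ ℕₚ.m≤n⇒m≤1+n) l₀<N fl₀<gl₀) (f≤g ℕₚ.≤-refl)
  ... | inj₂ refl = ℕₚ.+-mono-≤-< (∑-mono-≤ N (f≤g ∘ ℕₚ.m≤n⇒m≤1+n)) fl₀<gl₀

  module _ {P : A → Set} (P? : Decidable P) (x : A) (xs : List A) where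

    length-filter-∷-≤ : length (filter P? xs) ≤ length (filter P? (x ∷ xs))
    length-filter-∷-≤ with P? x
    ... | yes _ = ℕₚ.n≤1+n _
    ... | no  _ = ℕₚ.≤-refl

    length-filter-∷-< : P x → length (filter P? xs) < length (filter P? (x ∷ xs))
    length-filter-∷-< px with P? x
    ... | yes _  = ℕₚ.n<1+n _
    ... | no ¬px = ⊥-elim (¬px px)

  length-≤-∑-filter : {Q : ℕ → A → Set} (Q? : ∀ l → Decidable (Q l)) (N : ℕ) (xs : List A) →
    (∀ {x} → x ∈ xs → ∃[ l ] (l < N × Q l x)) → length xs ≤ ∑[ l < N ] length (filter (Q? l) xs)
  length-≤-∑-filter Q? N []       _       = z≤n
  length-≤-∑-filter Q? N (x ∷ xs) covered with l₀ , l₀<N , q ← covered (here refl) =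
    ℕₚ.≤-trans (s≤s (length-≤-∑-filter Q? N xs (covered ∘ there)))
      (∑-mono-< N (λ {l} _ → length-filter-∷-≤ (Q? l) x xs) l₀<N (length-filter-∷-< (Q? l₀) x xs q))

  length-filter+length-filter-¬ : {P : A → Set} (P? : Decidable P) (xs : List A) →
    length (filter P? xs) + length (filter (¬? ∘ P?) xs) ≡ length xs
  length-filter+length-filter-¬ P? [] = refl
  length-filter+length-filter-¬ P? (x ∷ xs) with P? x
  ... | yes _ = cong suc (length-filter+length-filter-¬ P? xs)
  ... | no  _ = trans (ℕₚ.+-suc _ _) (cong suc (length-filter+length-filter-¬ P? xs))

  length-cartesianProductWith : {C : Set} (f : A → B → C) (xs : List A) (ys : List B) →
    length (cartesianProductWith f xs ys) ≡ length xs * length ys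
  length-cartesianProductWith f []       ys = refl
  length-cartesianProductWith f (x ∷ xs) ys = trans (length-++ (List.map (f x) ys))
    (cong₂ _+_ (length-map (f x) ys) (length-cartesianProductWith f xs ys))

  unique⇒lookup-injective : {xs : List A} → Unique xs → Injective _≡_ _≡_ (List.lookup xs)
  unique⇒lookup-injective {xs = x ∷ xs} (x∉xs AllPairs.∷ _) {zero}  {zero}  _  = refl
  unique⇒lookup-injective {xs = x ∷ xs} (x∉xs AllPairs.∷ _) {zero}  {suc j} eq =
    ⊥-elim (All.lookup x∉xs (∈-lookup j) eq)
  unique⇒lookup-injective {xs = x ∷ xs} (x∉xs AllPairs.∷ _) {suc i} {zero}  eq =
    ⊥-elim (All.lookup x∉xs (∈-lookup i) (sym eq))
  unique⇒lookup-injective {xs = x ∷ xs} (_ AllPairs.∷ xs-unique) {suc i} {suc j} eq =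
    cong suc (unique⇒lookup-injective xs-unique eq)

  length-≤-via-injectiveRel : {B : Set} {xs : List A} {ys : List B} (R : A → B → Set) → Unique xs →
    (∀ {x} → x ∈ xs → ∃[ y ] (y ∈ ys × R x y)) → (∀ {x x′ y} → R x y → R x′ y → x ≡ x′) →
    length xs ≤ length ys
  length-≤-via-injectiveRel {B = B} {xs = xs} {ys} R xs-unique covered R-injective =
    injective⇒≤ {f = position} injective
    where
    image : ∀ i → ∃[ y ] (y ∈ ys × R (List.lookup xs i) y)
    image i = covered (∈-lookup i)
    position : Fin (length xs) → Fin (length ys)
    position i = Any.index (proj₁ (proj₂ (image i)))
    injective : Injective _≡_ _≡_ position
    injective {i} {j} eq with yᵢ , yᵢ∈ , Rᵢ ← image i | yⱼ , yⱼ∈ , Rⱼ ← image j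
      with refl ← Membership.index-injective (setoid B) yᵢ∈ yⱼ∈ eq
      = unique⇒lookup-injective xs-unique (R-injective Rᵢ Rⱼ)

  window : Word n → (i : ℕ) → i + j ≤ n → Fin j → Fin n
  window σ i h a = lookup σ (idx {i} h a)

  window-0 : {l m : ℕ} (τ : Word (l + m)) (h : l ≤ l + m) (a : Fin l) → window τ 0 h a ≡ lookup τ (a ↑ˡ m)
  window-0 {m = m} τ h a = cong (lookup τ) (toℕ-injective (trans (toℕ-fromℕ< _) (sym (toℕ-↑ˡ a m))))

  irrelevant-Σ? : {A : Set} {B : A → Set} → Irrelevant A → Dec A → (∀ a → Dec (B a)) → Dec (Σ A B)
  irrelevant-Σ? irr (no ¬a) B? = no (¬a ∘ proj₁)
  irrelevant-Σ? {B = B} irr (yes a) B? =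
    map′ (a ,_) (λ (a′ , b) → subst B (irr a′ a) b) (B? a)

  containsConsecAt? : (σ : Word n) (π : Word j) (i : ℕ) → Dec (ContainsConsecAt σ π i)
  containsConsecAt? σ π i = irrelevant-Σ? ℕₚ.≤-irrelevant (_ ℕₚ.≤? _) λ h → sameOrder? (window σ i h) (lookup π)

  perm⇒surjective : {σ : Word n} → IsPerm σ → ∀ y → ∃[ x ] lookup σ x ≡ y
  perm⇒surjective σ-perm = injective⇒surjective (σ-perm _ _)

  cons : Fin (suc n) → Word n → Word (suc n)
  cons v σ = v ∷ Vec.map (punchIn v) σ

  module _ {v : Fin (suc n)} {σ : Word n} where

    lookup-cons : (i : Fin n) → lookup (cons v σ) (suc i) ≡ punchIn v (lookup σ i)
    lookup-cons i = lookup-map i (punchIn v) σ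

    cons-perm : IsPerm σ → IsPerm (cons v σ)
    cons-perm σ-perm zero    zero    _  = refl
    cons-perm σ-perm zero    (suc j) eq = ⊥-elim (punchInᵢ≢i v _ (sym (trans eq (lookup-cons j))))
    cons-perm σ-perm (suc i) zero    eq = ⊥-elim (punchInᵢ≢i v _ (trans (sym (lookup-cons i)) eq))
    cons-perm σ-perm (suc i) (suc j) eq =
      cong suc (σ-perm i j (punchIn-injective v _ _ (trans (sym (lookup-cons i)) (trans eq (lookup-cons j)))))

    sameOrder-cons-suffix : (f : Fin j → Fin n) → SameOrder (lookup (cons v σ) ∘ suc ∘ f) (lookup σ ∘ f)
    sameOrder-cons-suffix f = sameOrder-respˡ (sym ∘ lookup-cons ∘ f) (sameOrder-punchIn v (lookup σ ∘ f))

  cons-injective : {v v′ : Fin (suc n)} {σ σ′ : Word n} → cons v σ ≡ cons v′ σ′ → v ≡ v′ × σ ≡ σ′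
  cons-injective {v = v} {σ = σ} {σ′} eq with ∷-injective eq
  ... | refl , map≡ = refl , lookup-≗⇒≡ λ i → punchIn-injective v _ _
          (trans (sym (lookup-map i _ σ)) (trans (cong (λ xs → lookup xs i) map≡) (lookup-map i _ σ′)))

  module Avoiders (P : PatternSet) where

    StartsWith : ℕ → Word n → Set
    StartsWith l τ = Σ (4 ≤ l) λ h → ContainsConsecAt τ (P l h) 0

    -- Opaque: unfolding these decision procedures wherever the filtered lists occur makes
    -- type checking very slow.
    opaque
      startsWith? : (l : ℕ) (τ : Word n) → Dec (StartsWith l τ)
      startsWith? l τ = irrelevant-Σ? ℕₚ.≤-irrelevant (4 ℕₚ.≤? l) λ h → containsConsecAt? τ (P l h) 0

    -- The bound only makes the property decidable: StartsWith l τ already forces l ≤ n.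
    NoPatternPrefix : Word n → Set
    NoPatternPrefix {n} τ = ∀ {l} → l < suc n → ¬ StartsWith l τ

    opaque
      noPatternPrefix? : (τ : Word n) → Dec (NoPatternPrefix τ)
      noPatternPrefix? {n} τ = ℕₚ.allUpTo? (λ l → ¬? (startsWith? l τ)) (suc n)

    extensions : List (Word n) → List (Word (suc n))
    extensions {n} = cartesianProductWith cons (allFin (suc n))

    avoiders : (n : ℕ) → List (Word n)
    avoiders zero    = [ [] ]
    avoiders (suc n) = filter noPatternPrefix? (extensions (avoiders n))

    ∈-extensions⁻ : {σs : List (Word n)} {τ : Word (suc n)} → τ ∈ extensions σs →
      ∃[ v ] ∃[ σ ] (σ ∈ σs × τ ≡ cons v σ)
    ∈-extensions⁻ {n} {σs} τ∈ with v , σ , _ , σ∈ , refl ← ∈-cartesianProductWith⁻ cons (allFin (suc n)) σs τ∈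
      = v , σ , σ∈ , refl

    ∈-avoiders⁻ : {τ : Word (suc n)} → τ ∈ avoiders (suc n) →
      NoPatternPrefix τ × ∃[ v ] ∃[ σ ] (σ ∈ avoiders n × τ ≡ cons v σ)
    ∈-avoiders⁻ τ∈ with τ∈ext , free ← ∈-filter⁻ noPatternPrefix? τ∈ = free , ∈-extensions⁻ τ∈ext

    extensions-unique : {σs : List (Word n)} → Unique σs → Unique (extensions σs)
    extensions-unique {n} = Unique.cartesianProductWith⁺ cons cons-injective (Unique.allFin⁺ (suc n))

    avoiders-unique : (n : ℕ) → Unique (avoiders n)
    avoiders-unique zero    = All.[] AllPairs.∷ AllPairs.[]
    avoiders-unique (suc n) = Unique.filter⁺ noPatternPrefix? (extensions-unique (avoiders-unique n))

    avoiders-sound : {τ : Word n} → τ ∈ avoiders n → IsPerm τ × AvoidsAll P τ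
    avoiders-sound {zero} (here refl) = (λ ()) , λ l 4≤l (i , i+l≤0 , _) →
      ℕₚ.<⇒≱ (ℕₚ.<-≤-trans (s≤s z≤n) 4≤l) (ℕₚ.≤-trans (ℕₚ.m≤n+m l i) i+l≤0)
    avoiders-sound {suc n} τ∈
      with free , v , σ , σ∈ , refl ← ∈-avoiders⁻ τ∈
      with σ-perm , σ-avoids ← avoiders-sound σ∈
      = cons-perm σ-perm , avoids
      where
      avoids : AvoidsAll P (cons v σ)
      avoids l 4≤l (zero , occurrence) = free (s≤s (proj₁ occurrence)) (4≤l , occurrence)
      avoids l 4≤l (suc i , h , o) = σ-avoids l 4≤l
        (i , h′ , sameOrder-trans (sameOrder-sym (sameOrder-cons-suffix {v = v} {σ} (idx h′))) o)
        where
        h′ : i + l ≤ n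
        h′ = ℕₚ.≤-pred h

    extensions-perm : {τ : Word (suc n)} → τ ∈ extensions (avoiders n) → IsPerm τ
    extensions-perm τ∈ with v , σ , σ∈ , refl ← ∈-extensions⁻ τ∈ = cons-perm (proj₁ (avoiders-sound σ∈))

    ancestor : (l : ℕ) {m : ℕ} {τ : Word (l + m)} → τ ∈ avoiders (l + m) →
      ∃[ ρ ] (ρ ∈ avoiders m × SameOrder (lookup τ ∘ (l ↑ʳ_)) (lookup ρ))

    extension-ancestor : (l : ℕ) {m : ℕ} {τ : Word (suc l + m)} → τ ∈ extensions (avoiders (l + m)) →
      ∃[ ρ ] (ρ ∈ avoiders m × SameOrder (lookup τ ∘ (suc l ↑ʳ_)) (lookup ρ))
    extension-ancestor l τ∈
      with v , σ , σ∈ , refl ← ∈-extensions⁻ τ∈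
      with ρ , ρ∈ , σ∼ρ ← ancestor l σ∈
      = ρ , ρ∈ , sameOrder-trans (sameOrder-cons-suffix {v = v} {σ} (l ↑ʳ_)) σ∼ρ

    ancestor zero    τ∈ = _ , τ∈ , λ a b → ⇔.refl
    ancestor (suc l) τ∈ = extension-ancestor l (proj₁ (∈-filter⁻ noPatternPrefix? τ∈))

  Increasing : Vec (Fin N) l → Set
  Increasing w = ∀ c d → c Fin.< d → lookup w c Fin.< lookup w d

  increasingVecs : (N l : ℕ) → List (Vec (Fin N) l)
  increasingVecs N       zero    = [ [] ]
  increasingVecs zero    (suc l) = List.[]
  increasingVecs (suc N) (suc l) =
    List.map (Vec.map suc) (increasingVecs N (suc l)) ++ List.map ((zero ∷_) ∘ Vec.map suc) (increasingVecs N l)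

  length-increasingVecs : ∀ N l → length (increasingVecs N l) ≡ N C l
  length-increasingVecs N       zero    = sym (trans (nCk≡nC[n∸k] {n = N} z≤n) (nCn≡1 N))
  length-increasingVecs zero    (suc l) = sym (k>n⇒nCk≡0 {n = 0} {k = suc l} (s≤s z≤n))
  length-increasingVecs (suc N) (suc l) = begin
    length (increasingVecs (suc N) (suc l))
      ≡⟨ length-++ (List.map (Vec.map suc) (increasingVecs N (suc l))) ⟩
    length (List.map (Vec.map suc) (increasingVecs N (suc l)))
      + length (List.map ((zero ∷_) ∘ Vec.map suc) (increasingVecs N l))
      ≡⟨ cong₂ _+_ (trans (length-map (Vec.map suc) (increasingVecs N (suc l))) (length-increasingVecs N (suc l)))
                   (trans (length-map ((zero ∷_) ∘ Vec.map suc) (increasingVecs N l)) (length-increasingVecs N l)) ⟩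
    N C suc l + N C l
      ≡⟨ ℕₚ.+-comm (N C suc l) (N C l) ⟩
    N C l + N C suc l
      ≡⟨ nCk+nC[k+1]≡[n+1]C[k+1] N l ⟩
    suc N C suc l ∎
    where open ≡-Reasoning

  nonzero⇒map-suc : {w : Vec (Fin (suc N)) l} → (∀ c → lookup w c ≢ zero) → ∃[ w′ ] w ≡ Vec.map suc w′
  nonzero⇒map-suc {w = []}        _  = [] , refl
  nonzero⇒map-suc {w = zero ∷ w}  nz = ⊥-elim (nz zero refl)
  nonzero⇒map-suc {w = suc x ∷ w} nz with w′ , refl ← nonzero⇒map-suc {w = w} (nz ∘ suc) = x ∷ w′ , refl

  increasing-map-suc⁻ : {w : Vec (Fin N) l} → Increasing (Vec.map suc w) → Increasing w
  increasing-map-suc⁻ {w = w} inc c d c<d =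
    ℕₚ.≤-pred (subst₂ Fin._<_ (lookup-map c suc w) (lookup-map d suc w) (inc c d c<d))

  increasing⇒tail-nonzero : {x : Fin (suc N)} {w : Vec (Fin (suc N)) l} → Increasing (x ∷ w) →
    ∀ c → lookup w c ≢ zero
  increasing⇒tail-nonzero {x = x} inc c eq = ℕₚ.n≮0 (subst (x Fin.<_) eq (inc zero (suc c) (s≤s z≤n)))

  ∈-increasingVecs : {w : Vec (Fin N) l} → Increasing w → w ∈ increasingVecs N l
  ∈-increasingVecs {N}     {zero}  {[]}         _   = here refl
  ∈-increasingVecs {zero}  {suc l} {() ∷ _}     _
  ∈-increasingVecs {suc N} {suc l} {zero ∷ w}   inc
    with w′ , refl ← nonzero⇒map-suc {w = w} (increasing⇒tail-nonzero inc)
    = ∈-++⁺ʳ (List.map (Vec.map suc) (increasingVecs N (suc l)))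
        (∈-map⁺ _ (∈-increasingVecs (increasing-map-suc⁻ {w = w′} λ c d c<d → inc (suc c) (suc d) (s≤s c<d))))
  ∈-increasingVecs {suc N} {suc l} {suc x ∷ w} inc
    with w′ , refl ← nonzero⇒map-suc {w = w} (increasing⇒tail-nonzero inc)
    = ∈-++⁺ˡ (∈-map⁺ _ (∈-increasingVecs (increasing-map-suc⁻ {w = x ∷ w′} inc)))

  sameOrder⇒increasing∘perm : {π : Word l} → IsPerm π → {f : Fin l → Fin N} → SameOrder f (lookup π) →
    ∃[ w ] (Increasing w × ∀ b → f b ≡ lookup w (lookup π b))
  sameOrder⇒increasing∘perm {π = π} π-perm {f} f∼π = w , w-increasing , f≡w∘π
    where
    π⁻¹ : Fin _ → Fin _
    π⁻¹ c = proj₁ (perm⇒surjective {σ = π} π-perm c)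
    π∘π⁻¹ : ∀ c → lookup π (π⁻¹ c) ≡ c
    π∘π⁻¹ c = proj₂ (perm⇒surjective {σ = π} π-perm c)
    w = tabulate (f ∘ π⁻¹)
    w-increasing : Increasing w
    w-increasing c d c<d = subst₂ Fin._<_ (sym (lookup∘tabulate (f ∘ π⁻¹) c)) (sym (lookup∘tabulate (f ∘ π⁻¹) d))
      (Equivalence.from (f∼π (π⁻¹ c) (π⁻¹ d)) (subst₂ Fin._<_ (sym (π∘π⁻¹ c)) (sym (π∘π⁻¹ d)) c<d))
    f≡w∘π : ∀ b → f b ≡ lookup w (lookup π b)
    f≡w∘π b = sym (trans (lookup∘tabulate (f ∘ π⁻¹) (lookup π b)) (cong f (π-perm _ _ (π∘π⁻¹ (lookup π b)))))

  ↑ˡ≢↑ʳ : (b : Fin l) (c : Fin m) → b ↑ˡ m ≢ l ↑ʳ c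
  ↑ˡ≢↑ʳ {l} {m} b c eq = ℕₚ.<⇒≱ (toℕ<n b) (begin
    l                ≤⟨ ℕₚ.m≤m+n l (toℕ c) ⟩
    l + toℕ c        ≡⟨ toℕ-↑ʳ l c ⟨
    toℕ (l ↑ʳ c)     ≡⟨ cong toℕ eq ⟨
    toℕ (b ↑ˡ m)     ≡⟨ toℕ-↑ˡ b m ⟩
    toℕ b            ∎)
    where open ℕₚ.≤-Reasoning

  -- The suffix positions are disjoint from the prefix positions, so by injectivity the
  -- suffix values of τ lie among the suffix values of τ′, and conversely.
  prefix≡∧suffix∼⇒≡ : {τ τ′ : Word (l + m)} → IsPerm τ → IsPerm τ′ →
    (∀ b → lookup τ (b ↑ˡ m) ≡ lookup τ′ (b ↑ˡ m)) → SameOrder (lookup τ ∘ (l ↑ʳ_)) (lookup τ′ ∘ (l ↑ʳ_)) →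
    τ ≡ τ′
  prefix≡∧suffix∼⇒≡ {l} {m} {τ} {τ′} τ-perm τ′-perm prefix≡ suffix∼ = lookup-≗⇒≡ pointwise
    where
    suffix⊆ : {σ σ′ : Word (l + m)} → IsPerm σ → IsPerm σ′ → (∀ b → lookup σ (b ↑ˡ m) ≡ lookup σ′ (b ↑ˡ m)) →
      ∀ c → ∃[ c′ ] lookup σ (l ↑ʳ c) ≡ lookup σ′ (l ↑ʳ c′)
    suffix⊆ {σ} {σ′} σ-perm σ′-perm pre c with perm⇒surjective {σ = σ′} σ′-perm (lookup σ (l ↑ʳ c))
    ... | p , σ′p≡ with splitAt-view l p
    ...   | inj₂ (c′ , refl) = c′ , sym σ′p≡
    ...   | inj₁ (b , refl)  = ⊥-elim (↑ˡ≢↑ʳ b c (σ-perm _ _ (trans (pre b) σ′p≡)))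

    suffix≡ : ∀ c → lookup τ (l ↑ʳ c) ≡ lookup τ′ (l ↑ʳ c)
    suffix≡ = sameOrder∧sameImage⇒≗ suffix∼
      (suffix⊆ {τ} {τ′} τ-perm τ′-perm prefix≡) (suffix⊆ {τ′} {τ} τ′-perm τ-perm (sym ∘ prefix≡))

    pointwise : ∀ p → lookup τ p ≡ lookup τ′ p
    pointwise p with splitAt-view l p
    ... | inj₁ (b , refl) = prefix≡ b
    ... | inj₂ (c , refl) = suffix≡ c

  patternsOfLength : ℕ → ℕ
  patternsOfLength (suc (suc (suc (suc _)))) = 1
  patternsOfLength _                         = 0

  module Counting (P : PatternSet) (P-perm : ∀ l h → IsPerm (P l h)) where
    open Avoiders P

    count : ℕ → ℕ
    count n = length (avoiders n)

    rejected : (n : ℕ) → List (Word (suc n))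
    rejected n = filter (¬? ∘ noPatternPrefix?) (extensions (avoiders n))

    ∈-rejected⁻ : {n : ℕ} {τ : Word (suc n)} → τ ∈ rejected n → τ ∈ extensions (avoiders n) × ¬ NoPatternPrefix τ
    ∈-rejected⁻ {n} = ∈-filter⁻ (¬? ∘ noPatternPrefix?) {xs = extensions (avoiders n)}

    rejected⇒startsWith : {n : ℕ} {τ : Word (suc n)} → τ ∈ rejected n → ∃[ l ] (l < suc (suc n) × StartsWith l τ)
    rejected⇒startsWith {n} {τ} τ∈ with ℕₚ.anyUpTo? (λ l → startsWith? l τ) (suc (suc n))
    ... | yes found = found
    ... | no none   = ⊥-elim (proj₂ (∈-rejected⁻ τ∈) λ l<2+n s → none (_ , l<2+n , s))

    -- A rejected τ starting with the pattern π of length L is encoded by the standardisation ρ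
    -- of its suffix and the increasing vector w of its prefix values; since its prefix is w ∘ π,
    -- τ is recovered from (ρ , w).
    length-startingWith-≤ : (l′ m : ℕ) (4≤L : 4 ≤ suc l′) →
      length (filter (startsWith? (suc l′)) (rejected (l′ + m))) ≤ ((suc l′ + m) C suc l′) * count m
    length-startingWith-≤ l′ m 4≤L =
      ℕₚ.≤-trans (length-≤-via-injectiveRel Encodes xs-unique encoded
                   (λ {τ} {τ′} {y} → Encodes-injective {τ} {τ′} {y}))
                 (ℕₚ.≤-reflexive length-ys)
      where
      L = suc l′
      π = P L 4≤L

      prefix : Word (L + m) → Fin L → Fin (L + m)
      prefix τ b = lookup τ (b ↑ˡ m)

      xs = filter (startsWith? L) (rejected (l′ + m))
      ys = cartesianProduct (avoiders m) (increasingVecs (L + m) L)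

      Encodes : Word (L + m) → Word m × Vec (Fin (L + m)) L → Set
      Encodes τ (ρ , w) =
        IsPerm τ × SameOrder (lookup τ ∘ (L ↑ʳ_)) (lookup ρ) × (∀ b → prefix τ b ≡ lookup w (lookup π b))

      Encodes-injective : ∀ {τ τ′ y} → Encodes τ y → Encodes τ′ y → τ ≡ τ′
      Encodes-injective {τ} {τ′} {ρ , w} (τ-perm , τ∼ρ , τ≡w) (τ′-perm , τ′∼ρ , τ′≡w) =
        prefix≡∧suffix∼⇒≡ {τ = τ} {τ′} τ-perm τ′-perm (λ b → trans (τ≡w b) (sym (τ′≡w b)))
          (sameOrder-trans τ∼ρ (sameOrder-sym τ′∼ρ))

      xs-unique : Unique xs
      xs-unique = Unique.filter⁺ (startsWith? L) (Unique.filter⁺ (¬? ∘ noPatternPrefix?)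
        (extensions-unique {σs = avoiders (l′ + m)} (avoiders-unique (l′ + m))))

      startsWith⇒prefix∼π : ∀ {τ} → StartsWith L τ → SameOrder (prefix τ) (lookup π)
      startsWith⇒prefix∼π {τ} (4≤L′ , h , window∼π) = sameOrder-respˡ (window-0 τ h)
        (subst (λ q → SameOrder (window τ 0 h) (lookup (P L q))) (ℕₚ.≤-irrelevant 4≤L′ 4≤L) window∼π)

      encoded : ∀ {τ} → τ ∈ xs → ∃[ y ] (y ∈ ys × Encodes τ y)
      encoded {τ} τ∈
        with τ∈rejected , startsWith ← ∈-filter⁻ (startsWith? L) τ∈
        with τ∈extensions , _ ← ∈-rejected⁻ τ∈rejected
        with ρ , ρ∈ , suffix∼ρ ← extension-ancestor l′ τ∈extensions
        with w , w-increasing , prefix≡w∘π ←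
               sameOrder⇒increasing∘perm {π = π} (P-perm L 4≤L) (startsWith⇒prefix∼π {τ} startsWith)
        = (ρ , w) , ∈-cartesianProduct⁺ ρ∈ (∈-increasingVecs w-increasing)
        , extensions-perm τ∈extensions , suffix∼ρ , prefix≡w∘π

      length-ys : length ys ≡ ((L + m) C L) * count m
      length-ys = trans (length-cartesianProductWith _,_ (avoiders m) (increasingVecs (L + m) L))
        (trans (cong (count m *_) (length-increasingVecs (L + m) L)) (ℕₚ.*-comm (count m) ((L + m) C L)))

    length-startingWith-short : {n l : ℕ} → l < 4 → (τs : List (Word n)) → length (filter (startsWith? l) τs) ≤ 0
    length-startingWith-short l<4 τs = ℕₚ.≤-reflexive (cong length (filter-none (startsWith? _)
      (All.universal (λ _ → ℕₚ.<⇒≱ l<4 ∘ proj₁) τs)))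

    length-startingWith-≤-weighted : (k l : ℕ) → l < suc (suc k) →
      length (filter (startsWith? l) (rejected k)) ≤ patternsOfLength l * ((suc k C l) * count (suc k ∸ l))
    length-startingWith-≤-weighted k 0 _ = length-startingWith-short (s≤s z≤n) (rejected k)
    length-startingWith-≤-weighted k 1 _ = length-startingWith-short (s≤s (s≤s z≤n)) (rejected k)
    length-startingWith-≤-weighted k 2 _ = length-startingWith-short (s≤s (s≤s (s≤s z≤n))) (rejected k)
    length-startingWith-≤-weighted k 3 _ = length-startingWith-short ℕₚ.≤-refl (rejected k)
    length-startingWith-≤-weighted k l@(suc l′@(suc (suc (suc _)))) l<2+k
      with m , refl ← ℕₚ.m≤n⇒∃[o]m+o≡n (ℕₚ.≤-pred (ℕₚ.≤-pred l<2+k))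
      = ℕₚ.≤-trans (length-startingWith-≤ l′ m (s≤s (s≤s (s≤s (s≤s z≤n))))) (ℕₚ.≤-reflexive (sym (trans
          (ℕₚ.*-identityˡ _) (cong (λ j → (suc k C l) * count j) (ℕₚ.m+n∸m≡n l′ m)))))

    count-recurrence : ∀ k → suc k * count k ≤
      count (suc k) + ∑[ l < suc (suc k) ] (patternsOfLength l * ((suc k C l) * count (suc k ∸ l)))
    count-recurrence k = begin
      suc k * count k
        ≡⟨ cong (_* count k) (length-tabulate {n = suc k} id) ⟨
      length (allFin (suc k)) * count k
        ≡⟨ length-cartesianProductWith cons (allFin (suc k)) (avoiders k) ⟨
      length (extensions (avoiders k))
        ≡⟨ length-filter+length-filter-¬ noPatternPrefix? (extensions (avoiders k)) ⟨
      count (suc k) + length (rejected k)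
        ≤⟨ ℕₚ.+-monoʳ-≤ (count (suc k)) (length-≤-∑-filter startsWith? _ (rejected k) rejected⇒startsWith) ⟩
      count (suc k) + ∑[ l < suc (suc k) ] length (filter (startsWith? l) (rejected k))
        ≤⟨ ℕₚ.+-monoʳ-≤ (count (suc k)) (∑-mono-≤ _ (length-startingWith-≤-weighted k _)) ⟩
      count (suc k) + ∑[ l < suc (suc k) ] (patternsOfLength l * ((suc k C l) * count (suc k ∸ l))) ∎
      where open ℕₚ.≤-Reasoning

module _ where

  open import Data.Rational using (_+_; _*_; -_)
  open +-*-Solver

  private
    variable
      p q r : ℚ

  toℚᵘ-ℕtoℚ : ∀ n → toℚᵘ (ℕtoℚ n) ℚᵘ.≃ ℚᵘ.mkℚᵘ (+ n) 0
  toℚᵘ-ℕtoℚ n = ℚₚ.toℚᵘ-fromℚᵘ (ℚᵘ.mkℚᵘ (+ n) 0)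

  ℕtoℚ-+ : ∀ m n → ℕtoℚ (m ℕ.+ n) ≡ ℕtoℚ m + ℕtoℚ n
  ℕtoℚ-+ m n = ℚₚ.toℚᵘ-injective (begin
    toℚᵘ (ℕtoℚ (m ℕ.+ n))                      ≈⟨ toℚᵘ-ℕtoℚ (m ℕ.+ n) ⟩
    ℚᵘ.mkℚᵘ (+ (m ℕ.+ n)) 0
      ≈⟨ ℚᵘ.*≡* (trans (cong (ℤ._* (+ 1 ℤ.* + 1)) (ℤₚ.pos-+ m n)) (+-homo (+ m) (+ n))) ⟩
    ℚᵘ.mkℚᵘ (+ m) 0 ℚᵘ.+ ℚᵘ.mkℚᵘ (+ n) 0        ≈⟨ ℚᵘₚ.+-cong (toℚᵘ-ℕtoℚ m) (toℚᵘ-ℕtoℚ n) ⟨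
    toℚᵘ (ℕtoℚ m) ℚᵘ.+ toℚᵘ (ℕtoℚ n)            ≈⟨ ℚₚ.toℚᵘ-homo-+ (ℕtoℚ m) (ℕtoℚ n) ⟨
    toℚᵘ (ℕtoℚ m + ℕtoℚ n)                     ∎)
    where
    open ℚᵘₚ.≃-Reasoning
    +-homo : ∀ (a b : ℤ) → (a ℤ.+ b) ℤ.* (+ 1 ℤ.* + 1) ≡ (a ℤ.* + 1 ℤ.+ b ℤ.* + 1) ℤ.* + 1
    +-homo = ℤ-Solver.solve-∀

  ℕtoℚ-* : ∀ m n → ℕtoℚ (m ℕ.* n) ≡ ℕtoℚ m * ℕtoℚ n
  ℕtoℚ-* m n = ℚₚ.toℚᵘ-injective (begin
    toℚᵘ (ℕtoℚ (m ℕ.* n))                      ≈⟨ toℚᵘ-ℕtoℚ (m ℕ.* n) ⟩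
    ℚᵘ.mkℚᵘ (+ (m ℕ.* n)) 0
      ≈⟨ ℚᵘ.*≡* (trans (cong (ℤ._* (+ 1 ℤ.* + 1)) (ℤₚ.pos-* m n)) (*-homo (+ m) (+ n))) ⟩
    ℚᵘ.mkℚᵘ (+ m) 0 ℚᵘ.* ℚᵘ.mkℚᵘ (+ n) 0        ≈⟨ ℚᵘₚ.*-cong (toℚᵘ-ℕtoℚ m) (toℚᵘ-ℕtoℚ n) ⟨
    toℚᵘ (ℕtoℚ m) ℚᵘ.* toℚᵘ (ℕtoℚ n)            ≈⟨ ℚₚ.toℚᵘ-homo-* (ℕtoℚ m) (ℕtoℚ n) ⟨
    toℚᵘ (ℕtoℚ m * ℕtoℚ n)                     ∎)
    where
    open ℚᵘₚ.≃-Reasoning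
    *-homo : ∀ (a b : ℤ) → (a ℤ.* b) ℤ.* (+ 1 ℤ.* + 1) ≡ (a ℤ.* b) ℤ.* + 1
    *-homo = ℤ-Solver.solve-∀

  ℕtoℚ-mono-≤ : ∀ {m n} → m ≤ n → ℕtoℚ m ℚ.≤ ℕtoℚ n
  ℕtoℚ-mono-≤ {m} {n} m≤n = ℚₚ.toℚᵘ-cancel-≤ (ℚᵘₚ.≤-respʳ-≃ (ℚᵘₚ.≃-sym (toℚᵘ-ℕtoℚ n))
    (ℚᵘₚ.≤-respˡ-≃ (ℚᵘₚ.≃-sym (toℚᵘ-ℕtoℚ m)) (ℚᵘ.*≤* (ℤₚ.*-monoʳ-≤-nonNeg (+ 1) (ℤ.+≤+ m≤n)))))

  ℕtoℚ-nonNeg : ∀ n → 0ℚ ℚ.≤ ℕtoℚ n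
  ℕtoℚ-nonNeg n = ℕtoℚ-mono-≤ {0} {n} z≤n

  *-monoˡ-≤ : 0ℚ ℚ.≤ r → p ℚ.≤ q → r * p ℚ.≤ r * q
  *-monoˡ-≤ {r} 0≤r = ℚₚ.*-monoˡ-≤-nonNeg r {{ℚ.nonNegative 0≤r}}

  *-monoʳ-≤ : 0ℚ ℚ.≤ r → p ℚ.≤ q → p * r ℚ.≤ q * r
  *-monoʳ-≤ {r} 0≤r = ℚₚ.*-monoʳ-≤-nonNeg r {{ℚ.nonNegative 0≤r}}

  *-nonNeg : 0ℚ ℚ.≤ p → 0ℚ ℚ.≤ q → 0ℚ ℚ.≤ p * q
  *-nonNeg {p} 0≤p 0≤q = subst (ℚ._≤ p * _) (ℚₚ.*-zeroʳ p) (*-monoˡ-≤ 0≤p 0≤q)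

  +-cancelʳ-≤ : ∀ r → p + r ℚ.≤ q + r → p ℚ.≤ q
  +-cancelʳ-≤ {p} {q} r p+r≤q+r = subst₂ ℚ._≤_ (cancel p) (cancel q) (ℚₚ.+-monoˡ-≤ (- r) p+r≤q+r)
    where
    cancel : ∀ x → x + r + - r ≡ x
    cancel x = solve 2 (λ x r → x :+ r :+ :- r := x) refl x r

  ^ℚ-nonNeg : ∀ n → 0ℚ ℚ.≤ p → 0ℚ ℚ.≤ p ^ℚ n
  ^ℚ-nonNeg zero    0≤p = ℚₚ.nonNegative⁻¹ 1ℚ
  ^ℚ-nonNeg (suc n) 0≤p = *-nonNeg 0≤p (^ℚ-nonNeg n 0≤p)

  ^ℚ-monoˡ-≤ : ∀ n → 0ℚ ℚ.≤ p → p ℚ.≤ q → p ^ℚ n ℚ.≤ q ^ℚ n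
  ^ℚ-monoˡ-≤ zero    0≤p p≤q = ℚₚ.≤-refl
  ^ℚ-monoˡ-≤ (suc n) 0≤p p≤q = ℚₚ.≤-trans (*-monoʳ-≤ (^ℚ-nonNeg n 0≤p) p≤q)
    (*-monoˡ-≤ (ℚₚ.≤-trans 0≤p p≤q) (^ℚ-monoˡ-≤ n 0≤p p≤q))

  ^ℚ-+ : ∀ p m n → p ^ℚ (m ℕ.+ n) ≡ p ^ℚ m * p ^ℚ n
  ^ℚ-+ p zero    n = sym (ℚₚ.*-identityˡ _)
  ^ℚ-+ p (suc m) n = trans (cong (p *_) (^ℚ-+ p m n)) (sym (ℚₚ.*-assoc p _ _))

  -- The same term as the coefficient in expPartial, so that expPartial unfolds to sums of expTerm.
  _!⁻¹ : ℕ → ℚ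
  n !⁻¹ = (+ 1 ℚ./ (n !)) {{n ℕₚ.!≢0}}

  !⁻¹-nonNeg : ∀ n → 0ℚ ℚ.≤ n !⁻¹
  !⁻¹-nonNeg n = ℚₚ.nonNegative⁻¹ _ {{ℚₚ.normalize-nonNeg 1 (n !) {{n ℕₚ.!≢0}}}}

  ℕtoℚ-*-inverse : ∀ d .{{_ : ℕ.NonZero d}} → ℕtoℚ d * (+ 1 ℚ./ d) ≡ 1ℚ
  ℕtoℚ-*-inverse (suc d) = ℚₚ.toℚᵘ-injective (begin
    toℚᵘ (ℕtoℚ (suc d) * (+ 1 ℚ./ suc d))                   ≈⟨ ℚₚ.toℚᵘ-homo-* (ℕtoℚ (suc d)) _ ⟩
    toℚᵘ (ℕtoℚ (suc d)) ℚᵘ.* toℚᵘ (+ 1 ℚ./ suc d)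
      ≈⟨ ℚᵘₚ.*-cong (toℚᵘ-ℕtoℚ (suc d)) (ℚₚ.toℚᵘ-fromℚᵘ (ℚᵘ.mkℚᵘ (+ 1) d)) ⟩
    ℚᵘ.mkℚᵘ (+ suc d) 0 ℚᵘ.* ℚᵘ.mkℚᵘ (+ 1) d                ≈⟨ ℚᵘ.*≡* (cancel (+ suc d)) ⟩
    ℚᵘ.1ℚᵘ                                                  ∎)
    where
    open ℚᵘₚ.≃-Reasoning
    cancel : ∀ (a : ℤ) → (a ℤ.* + 1) ℤ.* + 1 ≡ + 1 ℤ.* (+ 1 ℤ.* a)
    cancel = ℤ-Solver.solve-∀

  n!*n!⁻¹≡1 : ∀ n → ℕtoℚ (n !) * n !⁻¹ ≡ 1ℚ
  n!*n!⁻¹≡1 n = ℕtoℚ-*-inverse (n !) {{n ℕₚ.!≢0}}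

  [1+n]*[1+n]!⁻¹≡n!⁻¹ : ∀ n → ℕtoℚ (suc n) * suc n !⁻¹ ≡ n !⁻¹
  [1+n]*[1+n]!⁻¹≡n!⁻¹ n = begin
    N * X                    ≡⟨ ℚₚ.*-identityʳ (N * X) ⟨
    N * X * 1ℚ               ≡⟨ cong (N * X *_) (n!*n!⁻¹≡1 n) ⟨
    N * X * (F * Y)          ≡⟨ solve 4 (λ N X F Y → N :* X :* (F :* Y) := N :* F :* X :* Y) refl N X F Y ⟩
    N * F * X * Y            ≡⟨ cong (λ z → z * X * Y) (ℕtoℚ-* (suc n) (n !)) ⟨
    ℕtoℚ (suc n !) * X * Y   ≡⟨ cong (_* Y) (n!*n!⁻¹≡1 (suc n)) ⟩
    1ℚ * Y                   ≡⟨ ℚₚ.*-identityˡ Y ⟩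
    Y                        ∎
    where
    open ≡-Reasoning
    N = ℕtoℚ (suc n)
    X = suc n !⁻¹
    F = ℕtoℚ (n !)
    Y = n !⁻¹

  C*k!*[n∸k]!≡n! : ∀ {n k} → k ≤ n → (n C k) ℕ.* (k ! ℕ.* (n ∸ k) !) ≡ n !
  C*k!*[n∸k]!≡n! {n} {k} k≤n = trans (cong (ℕ._* (k ! ℕ.* (n ∸ k) !)) (nCk≡n!/k![n-k]! k≤n))
    (m/n*n≡m {{ℕₚ._!*_!≢0 k (n ∸ k)}} (k![n∸k]!∣n! k≤n))

  k!⁻¹*[n∸k]!⁻¹≡C*n!⁻¹ : ∀ {n k} → k ≤ n → k !⁻¹ * (n ∸ k) !⁻¹ ≡ ℕtoℚ (n C k) * n !⁻¹
  k!⁻¹*[n∸k]!⁻¹≡C*n!⁻¹ {n} {k} k≤n = sym (begin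
    B * Z                                ≡⟨ ℚₚ.*-identityʳ (B * Z) ⟨
    B * Z * 1ℚ                           ≡⟨ cong (B * Z *_) (n!*n!⁻¹≡1 k) ⟨
    B * Z * (K * Y₁)                     ≡⟨ ℚₚ.*-identityʳ (B * Z * (K * Y₁)) ⟨
    B * Z * (K * Y₁) * 1ℚ                ≡⟨ cong (B * Z * (K * Y₁) *_) (n!*n!⁻¹≡1 (n ∸ k)) ⟨
    B * Z * (K * Y₁) * (M * Y₂)
      ≡⟨ solve 6 (λ B Z K Y₁ M Y₂ → B :* Z :* (K :* Y₁) :* (M :* Y₂) := B :* (K :* M) :* Z :* (Y₁ :* Y₂))
           refl B Z K Y₁ M Y₂ ⟩
    B * (K * M) * Z * (Y₁ * Y₂)          ≡⟨ cong (λ x → x * Z * (Y₁ * Y₂)) (trans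
                                              (ℕtoℚ-* (n C k) (k ! ℕ.* (n ∸ k) !))
                                              (cong (B *_) (ℕtoℚ-* (k !) ((n ∸ k) !)))) ⟨
    ℕtoℚ ((n C k) ℕ.* (k ! ℕ.* (n ∸ k) !)) * Z * (Y₁ * Y₂)
                                         ≡⟨ cong (λ x → ℕtoℚ x * Z * (Y₁ * Y₂)) (C*k!*[n∸k]!≡n! k≤n) ⟩
    ℕtoℚ (n !) * Z * (Y₁ * Y₂)           ≡⟨ cong (_* (Y₁ * Y₂)) (n!*n!⁻¹≡1 n) ⟩
    1ℚ * (Y₁ * Y₂)                       ≡⟨ ℚₚ.*-identityˡ (Y₁ * Y₂) ⟩
    Y₁ * Y₂                              ∎)
    where
    open ≡-Reasoning
    B = ℕtoℚ (n C k)
    Z = n !⁻¹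
    K = ℕtoℚ (k !)
    M = ℕtoℚ ((n ∸ k) !)
    Y₁ = k !⁻¹
    Y₂ = (n ∸ k) !⁻¹

  ∑ℚ[<]-syntax : ℕ → (ℕ → ℚ) → ℚ
  ∑ℚ[<]-syntax zero    f = 0ℚ
  ∑ℚ[<]-syntax (suc N) f = ∑ℚ[<]-syntax N f + f N

  syntax ∑ℚ[<]-syntax N (λ l → e) = ∑ℚ[ l < N ] e

  ℕtoℚ-∑ : ∀ N (f : ℕ → ℕ) → ℕtoℚ (∑[ l < N ] f l) ≡ ∑ℚ[ l < N ] ℕtoℚ (f l)
  ℕtoℚ-∑ zero    f = refl
  ℕtoℚ-∑ (suc N) f = trans (ℕtoℚ-+ (∑[ l < N ] f l) (f N)) (cong (_+ ℕtoℚ (f N)) (ℕtoℚ-∑ N f))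

  ∑ℚ-*-distribʳ : ∀ N (f : ℕ → ℚ) x → (∑ℚ[ l < N ] f l) * x ≡ ∑ℚ[ l < N ] (f l * x)
  ∑ℚ-*-distribʳ zero    f x = ℚₚ.*-zeroˡ x
  ∑ℚ-*-distribʳ (suc N) f x =
    trans (ℚₚ.*-distribʳ-+ x (∑ℚ[ l < N ] f l) (f N)) (cong (_+ f N * x) (∑ℚ-*-distribʳ N f x))

  ∑ℚ-mono-≤ : ∀ N {f g : ℕ → ℚ} → (∀ {l} → l ℕ.< N → f l ℚ.≤ g l) → ∑ℚ[ l < N ] f l ℚ.≤ ∑ℚ[ l < N ] g l
  ∑ℚ-mono-≤ zero    f≤g = ℚₚ.≤-refl
  ∑ℚ-mono-≤ (suc N) f≤g = ℚₚ.+-mono-≤ (∑ℚ-mono-≤ N (f≤g ∘ ℕₚ.m≤n⇒m≤1+n)) (f≤g ℕₚ.≤-refl)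

  ∑ℚ-≤-∑ℚ-+ : ∀ j N {f : ℕ → ℚ} → (∀ l → 0ℚ ℚ.≤ f l) → ∑ℚ[ l < N ] f l ℚ.≤ ∑ℚ[ l < j ℕ.+ N ] f l
  ∑ℚ-≤-∑ℚ-+ zero    N 0≤f = ℚₚ.≤-refl
  ∑ℚ-≤-∑ℚ-+ (suc j) N {f} 0≤f = ℚₚ.≤-trans (∑ℚ-≤-∑ℚ-+ j N 0≤f)
    (subst (ℚ._≤ ∑ℚ[ l < j ℕ.+ N ] f l + f (j ℕ.+ N)) (ℚₚ.+-identityʳ _)
      (ℚₚ.+-monoʳ-≤ (∑ℚ[ l < j ℕ.+ N ] f l) (0≤f (j ℕ.+ N))))

  expTerm : ℚ → ℕ → ℚ
  expTerm s l = s ^ℚ l * l !⁻¹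

  expTerm-nonNeg : ∀ {s} → 0ℚ ℚ.≤ s → ∀ l → 0ℚ ℚ.≤ expTerm s l
  expTerm-nonNeg 0≤s l = *-nonNeg (^ℚ-nonNeg l 0≤s) (!⁻¹-nonNeg l)

  s*expTerm≡[1+k]*expTerm : ∀ s k → s * expTerm s k ≡ ℕtoℚ (suc k) * expTerm s (suc k)
  s*expTerm≡[1+k]*expTerm s k = begin
    s * (s ^ℚ k * k !⁻¹)                            ≡⟨ cong (λ x → s * (s ^ℚ k * x)) ([1+n]*[1+n]!⁻¹≡n!⁻¹ k) ⟨
    s * (s ^ℚ k * (ℕtoℚ (suc k) * suc k !⁻¹))
      ≡⟨ solve 4 (λ s p n x → s :* (p :* (n :* x)) := n :* (s :* p :* x)) refl
           s (s ^ℚ k) (ℕtoℚ (suc k)) (suc k !⁻¹) ⟩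
    ℕtoℚ (suc k) * (s * s ^ℚ k * suc k !⁻¹)        ∎
    where open ≡-Reasoning

  expTerm*expTerm≡C*expTerm : ∀ s {n l} → l ≤ n → expTerm s l * expTerm s (n ∸ l) ≡ ℕtoℚ (n C l) * expTerm s n
  expTerm*expTerm≡C*expTerm s {n} {l} l≤n = begin
    s ^ℚ l * l !⁻¹ * (s ^ℚ (n ∸ l) * (n ∸ l) !⁻¹)
      ≡⟨ solve 4 (λ p x q y → p :* x :* (q :* y) := p :* q :* (x :* y)) refl
           (s ^ℚ l) (l !⁻¹) (s ^ℚ (n ∸ l)) ((n ∸ l) !⁻¹) ⟩
    s ^ℚ l * s ^ℚ (n ∸ l) * (l !⁻¹ * (n ∸ l) !⁻¹)
      ≡⟨ cong₂ _*_ (trans (sym (^ℚ-+ s l (n ∸ l))) (cong (s ^ℚ_) (ℕₚ.m+[n∸m]≡n l≤n))) (k!⁻¹*[n∸k]!⁻¹≡C*n!⁻¹ l≤n) ⟩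
    s ^ℚ n * (ℕtoℚ (n C l) * n !⁻¹)
      ≡⟨ solve 3 (λ p c x → p :* (c :* x) := c :* (p :* x)) refl (s ^ℚ n) (ℕtoℚ (n C l)) (n !⁻¹) ⟩
    ℕtoℚ (n C l) * expTerm s n ∎
    where open ≡-Reasoning

  -- The scaled counts a n sⁿ / n! are non-decreasing: by strong induction every a (n ∸ l) in
  -- the recurrence is controlled by the current scaled count c, which gives
  -- s c ≤ c′ + (s − 1) c for the next scaled count c′.
  module GrowthBound
    (a w : ℕ → ℕ) (s : ℚ) (0≤s : 0ℚ ℚ.≤ s) (a₀ : a 0 ≡ 1) (w₀ : w 0 ≡ 0)
    (recurrence : ∀ k → suc k ℕ.* a k ≤
      a (suc k) ℕ.+ ∑[ l < suc (suc k) ] (w l ℕ.* ((suc k C l) ℕ.* a (suc k ∸ l))))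
    (weights-bound : ∀ N → ∑ℚ[ l < N ] (ℕtoℚ (w l) * expTerm s l) + 1ℚ ℚ.≤ s)
    where

    term : ℕ → ℚ
    term = expTerm s

    scaled : ℕ → ℚ
    scaled n = ℕtoℚ (a n) * term n

    weightSum : ℕ → ℚ
    weightSum N = ∑ℚ[ l < N ] (ℕtoℚ (w l) * term l)

    term-nonNeg : ∀ l → 0ℚ ℚ.≤ term l
    term-nonNeg = expTerm-nonNeg 0≤s

    scaled-nonNeg : ∀ n → 0ℚ ℚ.≤ scaled n
    scaled-nonNeg n = *-nonNeg (ℕtoℚ-nonNeg (a n)) (term-nonNeg n)

    binomial-term : ∀ {n l} → l ≤ n → ℕtoℚ ((n C l) ℕ.* a (n ∸ l)) * term n ≡ term l * scaled (n ∸ l)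
    binomial-term {n} {l} l≤n = begin
      ℕtoℚ ((n C l) ℕ.* a (n ∸ l)) * term n  ≡⟨ cong (_* term n) (ℕtoℚ-* (n C l) (a (n ∸ l))) ⟩
      ℕtoℚ (n C l) * A * term n
        ≡⟨ solve 3 (λ c A t → c :* A :* t := A :* (c :* t)) refl (ℕtoℚ (n C l)) A (term n) ⟩
      A * (ℕtoℚ (n C l) * term n)            ≡⟨ cong (A *_) (expTerm*expTerm≡C*expTerm s l≤n) ⟨
      A * (term l * term (n ∸ l))
        ≡⟨ solve 3 (λ A x y → A :* (x :* y) := x :* (A :* y)) refl A (term l) (term (n ∸ l)) ⟩
      term l * scaled (n ∸ l)                ∎
      where
      open ≡-Reasoning
      A = ℕtoℚ (a (n ∸ l))

    weighted-term-≤ : ∀ {k l} → (∀ {j} → j ≤ k → scaled j ℚ.≤ scaled k) → l < suc (suc k) →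
      ℕtoℚ (w l ℕ.* ((suc k C l) ℕ.* a (suc k ∸ l))) * term (suc k) ℚ.≤ ℕtoℚ (w l) * term l * scaled k
    weighted-term-≤ {k} {zero} _ _ rewrite w₀ = ℚₚ.≤-reflexive (begin
      0ℚ * term (suc k)        ≡⟨ ℚₚ.*-zeroˡ (term (suc k)) ⟩
      0ℚ                       ≡⟨ ℚₚ.*-zeroˡ (scaled k) ⟨
      0ℚ * scaled k            ≡⟨ cong (_* scaled k) (ℚₚ.*-zeroˡ (term 0)) ⟨
      0ℚ * term 0 * scaled k   ∎)
      where open ≡-Reasoning
    weighted-term-≤ {k} {l@(suc l′)} mono l<2+k = begin
      ℕtoℚ (w l ℕ.* B) * term (suc k)  ≡⟨ cong (_* term (suc k)) (ℕtoℚ-* (w l) B) ⟩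
      W * ℕtoℚ B * term (suc k)        ≡⟨ ℚₚ.*-assoc W (ℕtoℚ B) (term (suc k)) ⟩
      W * (ℕtoℚ B * term (suc k))      ≡⟨ cong (W *_) (binomial-term (ℕₚ.≤-pred l<2+k)) ⟩
      W * (term l * scaled (k ∸ l′))   ≤⟨ *-monoˡ-≤ (ℕtoℚ-nonNeg (w l))
                                            (*-monoˡ-≤ (term-nonNeg l) (mono (ℕₚ.m∸n≤m k l′))) ⟩
      W * (term l * scaled k)          ≡⟨ ℚₚ.*-assoc W (term l) (scaled k) ⟨
      W * term l * scaled k            ∎
      where
      open ℚₚ.≤-Reasoning
      B = (suc k C l) ℕ.* a (suc k ∸ l)
      W = ℕtoℚ (w l)

    s*scaled≡[1+k]*a*term : ∀ k → s * scaled k ≡ ℕtoℚ (suc k ℕ.* a k) * term (suc k)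
    s*scaled≡[1+k]*a*term k = begin
      s * (A * term k)                   ≡⟨ solve 3 (λ s A t → s :* (A :* t) := A :* (s :* t)) refl s A (term k) ⟩
      A * (s * term k)                   ≡⟨ cong (A *_) (s*expTerm≡[1+k]*expTerm s k) ⟩
      A * (ℕtoℚ (suc k) * term (suc k))
        ≡⟨ solve 3 (λ A N t → A :* (N :* t) := N :* A :* t) refl A (ℕtoℚ (suc k)) (term (suc k)) ⟩
      ℕtoℚ (suc k) * A * term (suc k)    ≡⟨ cong (_* term (suc k)) (ℕtoℚ-* (suc k) (a k)) ⟨
      ℕtoℚ (suc k ℕ.* a k) * term (suc k) ∎
      where
      open ≡-Reasoning
      A = ℕtoℚ (a k)

    scaled-recurrence : ∀ k → (∀ {j} → j ≤ k → scaled j ℚ.≤ scaled k) →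
      s * scaled k ℚ.≤ scaled (suc k) + weightSum (suc (suc k)) * scaled k
    scaled-recurrence k mono = begin
      s * scaled k
        ≡⟨ s*scaled≡[1+k]*a*term k ⟩
      ℕtoℚ (n ℕ.* a k) * term n
        ≤⟨ *-monoʳ-≤ (term-nonNeg n) (ℕtoℚ-mono-≤ (recurrence k)) ⟩
      ℕtoℚ (a n ℕ.+ ∑[ l < suc n ] f l) * term n
        ≡⟨ cong (_* term n) (trans (ℕtoℚ-+ (a n) _) (cong (λ x → ℕtoℚ (a n) + x) (ℕtoℚ-∑ (suc n) f))) ⟩
      (ℕtoℚ (a n) + ∑ℚ[ l < suc n ] ℕtoℚ (f l)) * term n
        ≡⟨ trans (ℚₚ.*-distribʳ-+ (term n) (ℕtoℚ (a n)) _)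
                 (cong (λ x → scaled n + x) (∑ℚ-*-distribʳ (suc n) (λ l → ℕtoℚ (f l)) (term n))) ⟩
      scaled n + ∑ℚ[ l < suc n ] (ℕtoℚ (f l) * term n)
        ≤⟨ ℚₚ.+-monoʳ-≤ (scaled n) (∑ℚ-mono-≤ (suc n) (weighted-term-≤ mono)) ⟩
      scaled n + ∑ℚ[ l < suc n ] (ℕtoℚ (w l) * term l * scaled k)
        ≡⟨ cong (λ x → scaled n + x) (∑ℚ-*-distribʳ (suc n) (λ l → ℕtoℚ (w l) * term l) (scaled k)) ⟨
      scaled n + weightSum (suc n) * scaled k ∎
      where
      open ℚₚ.≤-Reasoning
      n = suc k
      f : ℕ → ℕ
      f l = w l ℕ.* ((n C l) ℕ.* a (n ∸ l))

    scaled-step : ∀ k → (∀ {j} → j ≤ k → scaled j ℚ.≤ scaled k) → scaled k ℚ.≤ scaled (suc k)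
    scaled-step k mono = +-cancelʳ-≤ (G * scaled k) (begin
      scaled k + G * scaled k  ≡⟨ solve 2 (λ c G → c :+ G :* c := (G :+ con 1ℚ) :* c) refl (scaled k) G ⟩
      (G + 1ℚ) * scaled k      ≤⟨ *-monoʳ-≤ (scaled-nonNeg k) (weights-bound (suc (suc k))) ⟩
      s * scaled k             ≤⟨ scaled-recurrence k mono ⟩
      scaled (suc k) + G * scaled k ∎)
      where
      open ℚₚ.≤-Reasoning
      G = weightSum (suc (suc k))

    scaled-mono : ∀ {j n} → j ≤ n → scaled j ℚ.≤ scaled n
    scaled-mono {n = zero}  z≤n = ℚₚ.≤-refl
    scaled-mono {j} {suc n} j≤1+n with ℕₚ.m≤n⇒m<n∨m≡n j≤1+n
    ... | inj₂ refl  = ℚₚ.≤-refl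
    ... | inj₁ j<1+n = ℚₚ.≤-trans (scaled-mono (ℕₚ.≤-pred j<1+n)) (scaled-step n (λ {i} → scaled-mono {i} {n}))

    n!≤aₙ*sⁿ : ∀ n → ℕtoℚ (n !) ℚ.≤ ℕtoℚ (a n) * s ^ℚ n
    n!≤aₙ*sⁿ n = begin
      ℕtoℚ (n !)                    ≡⟨ ℚₚ.*-identityʳ (ℕtoℚ (n !)) ⟨
      ℕtoℚ (n !) * 1ℚ               ≡⟨ cong (λ x → ℕtoℚ (n !) * (ℕtoℚ x * term 0)) a₀ ⟨
      ℕtoℚ (n !) * scaled 0         ≤⟨ *-monoˡ-≤ (ℕtoℚ-nonNeg (n !)) (scaled-mono z≤n) ⟩
      ℕtoℚ (n !) * scaled n
        ≡⟨ solve 4 (λ F A p x → F :* (A :* (p :* x)) := A :* p :* (F :* x)) refl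
             (ℕtoℚ (n !)) (ℕtoℚ (a n)) (s ^ℚ n) (n !⁻¹) ⟩
      ℕtoℚ (a n) * s ^ℚ n * (ℕtoℚ (n !) * n !⁻¹)
                                    ≡⟨ cong (ℕtoℚ (a n) * s ^ℚ n *_) (n!*n!⁻¹≡1 n) ⟩
      ℕtoℚ (a n) * s ^ℚ n * 1ℚ      ≡⟨ ℚₚ.*-identityʳ _ ⟩
      ℕtoℚ (a n) * s ^ℚ n           ∎
      where open ℚₚ.≤-Reasoning

  6*expPartial4≡ : ∀ s → ℕtoℚ 6 * expPartial 4 s ≡ ℕtoℚ 6 + (ℕtoℚ 6 * s + ℕtoℚ 3 * (s ^ℚ 2) + s ^ℚ 3)
  6*expPartial4≡ = solve 1 (λ s →
    con (ℕtoℚ 6) :* (con 0ℚ :+ con 1ℚ :* con (0 !⁻¹) :+ (s :* con 1ℚ) :* con (1 !⁻¹)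
      :+ (s :* (s :* con 1ℚ)) :* con (2 !⁻¹) :+ (s :* (s :* (s :* con 1ℚ))) :* con (3 !⁻¹))
    := con (ℕtoℚ 6) :+ (con (ℕtoℚ 6) :* s :+ con (ℕtoℚ 3) :* (s :* (s :* con 1ℚ)) :+ s :* (s :* (s :* con 1ℚ))))
    refl

  patternWeights+expPartial4≡expPartial : ∀ s M →
    ∑ℚ[ l < 4 ℕ.+ M ] (ℕtoℚ (patternsOfLength l) * expTerm s l) + expPartial 4 s ≡ expPartial (4 ℕ.+ M) s
  patternWeights+expPartial4≡expPartial s zero = solve 5 (λ t₀ t₁ t₂ t₃ e →
    con 0ℚ :+ con 0ℚ :* t₀ :+ con 0ℚ :* t₁ :+ con 0ℚ :* t₂ :+ con 0ℚ :* t₃ :+ e := e) refl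
    (expTerm s 0) (expTerm s 1) (expTerm s 2) (expTerm s 3) (expPartial 4 s)
  patternWeights+expPartial4≡expPartial s (suc M) = trans
    (solve 3 (λ x t e → x :+ con 1ℚ :* t :+ e := x :+ e :+ t) refl
      (∑ℚ[ l < 4 ℕ.+ M ] (ℕtoℚ (patternsOfLength l) * expTerm s l)) (expTerm s (4 ℕ.+ M)) (expPartial 4 s))
    (cong (_+ expTerm s (4 ℕ.+ M)) (patternWeights+expPartial4≡expPartial s M))

  -- f(s) = eˢ − 2s − s²/2 − s³/6 < 0 says that the tail Σ_{l ≥ 4} sˡ/l! = eˢ − 1 − s − s²/2 − s³/6
  -- is below s − 1.
  patternWeights-bound : ∀ s ε → 0ℚ ℚ.≤ s → 0ℚ ℚ.< ε →
    (∀ N → ℕtoℚ 6 * expPartial N s + ε ℚ.≤ ℕtoℚ 12 * s + ℕtoℚ 3 * (s ^ℚ 2) + s ^ℚ 3) →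
    ∀ N → ∑ℚ[ l < N ] (ℕtoℚ (patternsOfLength l) * expTerm s l) + 1ℚ ℚ.≤ s
  patternWeights-bound s ε 0≤s 0<ε f[s]<0 N =
    ℚₚ.≤-trans (ℚₚ.+-monoˡ-≤ 1ℚ (∑ℚ-≤-∑ℚ-+ 4 N weight-nonNeg)) (ℚₚ.*-cancelˡ-≤-pos (ℕtoℚ 6) six-times)
    where
    T = ∑ℚ[ l < 4 ℕ.+ N ] (ℕtoℚ (patternsOfLength l) * expTerm s l)
    K = ℕtoℚ 6 * s + ℕtoℚ 3 * (s ^ℚ 2) + s ^ℚ 3
    X = ℕtoℚ 6 * (T + 1ℚ)

    weight-nonNeg : ∀ l → 0ℚ ℚ.≤ ℕtoℚ (patternsOfLength l) * expTerm s l
    weight-nonNeg l = *-nonNeg (ℕtoℚ-nonNeg (patternsOfLength l)) (expTerm-nonNeg 0≤s l)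

    lhs : ℕtoℚ 6 * expPartial (4 ℕ.+ N) s + ε ≡ X + ε + K
    lhs = begin
      ℕtoℚ 6 * expPartial (4 ℕ.+ N) s + ε
        ≡⟨ cong (λ x → ℕtoℚ 6 * x + ε) (patternWeights+expPartial4≡expPartial s N) ⟨
      ℕtoℚ 6 * (T + expPartial 4 s) + ε
        ≡⟨ solve 4 (λ T E ε six → six :* (T :+ E) :+ ε := six :* T :+ six :* E :+ ε) refl
             T (expPartial 4 s) ε (ℕtoℚ 6) ⟩
      ℕtoℚ 6 * T + ℕtoℚ 6 * expPartial 4 s + ε
        ≡⟨ cong (λ x → ℕtoℚ 6 * T + x + ε) (6*expPartial4≡ s) ⟩
      ℕtoℚ 6 * T + (ℕtoℚ 6 + K) + ε
        ≡⟨ solve 4 (λ T K ε six → six :* T :+ (six :+ K) :+ ε := six :* (T :+ con 1ℚ) :+ ε :+ K) refl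
             T K ε (ℕtoℚ 6) ⟩
      X + ε + K ∎
      where open ≡-Reasoning

    rhs : ℕtoℚ 12 * s + ℕtoℚ 3 * (s ^ℚ 2) + s ^ℚ 3 ≡ ℕtoℚ 6 * s + K
    rhs = solve 3 (λ s s² s³ → con (ℕtoℚ 12) :* s :+ con (ℕtoℚ 3) :* s² :+ s³
                             := con (ℕtoℚ 6) :* s :+ (con (ℕtoℚ 6) :* s :+ con (ℕtoℚ 3) :* s² :+ s³))
            refl s (s ^ℚ 2) (s ^ℚ 3)

    six-times : X ℚ.≤ ℕtoℚ 6 * s
    six-times = ℚₚ.≤-trans (subst (ℚ._≤ X + ε) (ℚₚ.+-identityʳ X) (ℚₚ.+-monoʳ-≤ X (ℚₚ.<⇒≤ 0<ε)))
      (+-cancelʳ-≤ K (subst₂ ℚ._≤_ lhs rhs (f[s]<0 (4 ℕ.+ N))))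

  -- Witness s = 3/2: from l = 5 on, consecutive terms of the series for e^{3/2} shrink by a
  -- factor ≤ 1/4, so every partial sum is at most E₅ + (4/3)·s⁵/5!, a bound checked numerically.
  module ThreeHalves where

    s : ℚ
    s = + 3 ℚ./ 2

    0<s : 0ℚ ℚ.< s
    0<s = toWitness {a? = 0ℚ ℚₚ.<? s} tt

    t : ℕ → ℚ
    t = expTerm s

    E : ℕ → ℚ
    E N = expPartial N s

    bound : ℚ
    bound = E 5 + (+ 4 ℚ./ 3) * t 5

    4*t[6+M]≤t[5+M] : ∀ M → ℕtoℚ 4 * t (6 ℕ.+ M) ℚ.≤ t (5 ℕ.+ M)
    4*t[6+M]≤t[5+M] M = ℚₚ.*-cancelˡ-≤-pos s {{ℚ.positive 0<s}} (begin
      s * (ℕtoℚ 4 * t′)         ≡⟨ solve 3 (λ s f t → s :* (f :* t) := f :* s :* t) refl s (ℕtoℚ 4) t′ ⟩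
      ℕtoℚ 4 * s * t′           ≤⟨ *-monoʳ-≤ (expTerm-nonNeg (ℚₚ.<⇒≤ 0<s) (6 ℕ.+ M)) (ℕtoℚ-mono-≤ (ℕₚ.m≤m+n 6 M)) ⟩
      ℕtoℚ (6 ℕ.+ M) * t′       ≡⟨ s*expTerm≡[1+k]*expTerm s (5 ℕ.+ M) ⟨
      s * t (5 ℕ.+ M)           ∎)
      where
      open ℚₚ.≤-Reasoning
      t′ = t (6 ℕ.+ M)

    E+tail≤bound : ∀ M → E (5 ℕ.+ M) + (+ 4 ℚ./ 3) * t (5 ℕ.+ M) ℚ.≤ bound
    E+tail≤bound zero    = ℚₚ.≤-refl
    E+tail≤bound (suc M) = ℚₚ.≤-trans (begin
      e + x + (+ 4 ℚ./ 3) * x′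
        ≡⟨ solve 3 (λ e x x′ → e :+ x :+ con (+ 4 ℚ./ 3) :* x′
                              := e :+ x :+ con (+ 1 ℚ./ 3) :* (con (ℕtoℚ 4) :* x′)) refl e x x′ ⟩
      e + x + (+ 1 ℚ./ 3) * (ℕtoℚ 4 * x′)
        ≤⟨ ℚₚ.+-monoʳ-≤ (e + x) (*-monoˡ-≤ (toWitness {a? = 0ℚ ℚₚ.≤? + 1 ℚ./ 3} tt) (4*t[6+M]≤t[5+M] M)) ⟩
      e + x + (+ 1 ℚ./ 3) * x
        ≡⟨ solve 2 (λ e x → e :+ x :+ con (+ 1 ℚ./ 3) :* x := e :+ con (+ 4 ℚ./ 3) :* x) refl e x ⟩
      e + (+ 4 ℚ./ 3) * x ∎) (E+tail≤bound M)
      where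
      open ℚₚ.≤-Reasoning
      e = E (5 ℕ.+ M)
      x = t (5 ℕ.+ M)
      x′ = t (6 ℕ.+ M)

    E≤bound : ∀ N → E N ℚ.≤ bound
    E≤bound 0 = toWitness {a? = E 0 ℚₚ.≤? bound} tt
    E≤bound 1 = toWitness {a? = E 1 ℚₚ.≤? bound} tt
    E≤bound 2 = toWitness {a? = E 2 ℚₚ.≤? bound} tt
    E≤bound 3 = toWitness {a? = E 3 ℚₚ.≤? bound} tt
    E≤bound 4 = toWitness {a? = E 4 ℚₚ.≤? bound} tt
    E≤bound (suc (suc (suc (suc (suc M))))) = ℚₚ.≤-trans
      (subst (ℚ._≤ E (5 ℕ.+ M) + (+ 4 ℚ./ 3) * t (5 ℕ.+ M)) (ℚₚ.+-identityʳ (E (5 ℕ.+ M)))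
        (ℚₚ.+-monoʳ-≤ (E (5 ℕ.+ M)) (*-nonNeg (toWitness {a? = 0ℚ ℚₚ.≤? + 4 ℚ./ 3} tt)
          (expTerm-nonNeg (ℚₚ.<⇒≤ 0<s) (5 ℕ.+ M)))))
      (E+tail≤bound M)

    aboveAlpha-2 : AboveAlpha (+ 2 ℚ./ 1)
    aboveAlpha-2 = s , 0<s , toWitness {a? = s ℚₚ.<? + 2 ℚ./ 1} tt , 1ℚ , toWitness {a? = 0ℚ ℚₚ.<? 1ℚ} tt , λ N →
      ℚₚ.≤-trans (ℚₚ.+-monoˡ-≤ 1ℚ (*-monoˡ-≤ (ℕtoℚ-nonNeg 6) (E≤bound N)))
        (toWitness {a? = ℕtoℚ 6 * bound + 1ℚ ℚₚ.≤? ℕtoℚ 12 * s + ℕtoℚ 3 * (s ^ℚ 2) + s ^ℚ 3} tt)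

  factorial-bound⇒∃ : {A : Set} {P : A → Set} {n : ℕ} {r : ℚ} →
    ∃[ L ] (Unique L × All P L × ℕtoℚ (n !) ℚ.≤ ℕtoℚ (length L) * r ^ℚ n) → ∃[ x ] P x
  factorial-bound⇒∃ (x ∷ _ , _ , px All.∷ _ , _) = x , px
  factorial-bound⇒∃ {n = n} {r} ([] , _ , _ , n!≤0) = ⊥-elim (ℚₚ.<-irrefl refl
    (ℚₚ.<-≤-trans (ℚₚ.positive⁻¹ 1ℚ)
      (ℚₚ.≤-trans (ℕtoℚ-mono-≤ (ℕₚ.1≤n! n)) (ℚₚ.≤-trans n!≤0 (ℚₚ.≤-reflexive (ℚₚ.*-zeroˡ (r ^ℚ n)))))))

corollary3p5 : (P : PatternSet) → ((l : ℕ) (h : 4 ≤ l) → IsPerm (P l h)) →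
    ((n : ℕ) (r : ℚ) → AboveAlpha r →
      ∃[ L ] (Unique L × All (λ (σ : Word n) → IsPerm σ × AvoidsAll P σ) L ×
        ℕtoℚ (n !) ℚ.≤ ℕtoℚ (length L) ℚ.* (r ^ℚ n)))
    × ((n : ℕ) → ∃[ σ ] (IsPerm {n} σ × AvoidsAll P σ))
corollary3p5 P P-perm = lower-bound , existence
  where
  open Avoiders P
  open Counting P P-perm

  lower-bound : (n : ℕ) (r : ℚ) → AboveAlpha r →
    ∃[ L ] (Unique L × All (λ (σ : Word n) → IsPerm σ × AvoidsAll P σ) L ×
      ℕtoℚ (n !) ℚ.≤ ℕtoℚ (length L) ℚ.* (r ^ℚ n))
  lower-bound n r (s , 0<s , s<r , ε , 0<ε , f[s]<0) =
    avoiders n , avoiders-unique n , All.tabulate avoiders-sound ,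
    ℚₚ.≤-trans (GrowthBound.n!≤aₙ*sⁿ count patternsOfLength s 0≤s refl refl count-recurrence
                  (patternWeights-bound s ε 0≤s 0<ε f[s]<0) n)
               (*-monoˡ-≤ (ℕtoℚ-nonNeg (count n)) (^ℚ-monoˡ-≤ n 0≤s (ℚₚ.<⇒≤ s<r)))
    where
    0≤s = ℚₚ.<⇒≤ 0<s

  existence : (n : ℕ) → ∃[ σ ] (IsPerm {n} σ × AvoidsAll P σ)
  existence n = factorial-bound⇒∃ {n = n} (lower-bound n _ ThreeHalves.aboveAlpha-2)
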